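{- Let $G=(V,E)$ be a finite simple graph with at least one edge, let $\phi:V\to\mathbb{Z}_{>0}$ be a (not necessarily proper) vertex coloring with positive integers, let $I$ be a $\phi$-maximum independent set of $G$, and write $U=V\setminus I=\{u_k: k\in[1,p]\}$. Suppose that for each $k\in[1,p-1]$, the vertex $u_k$ has at most $\phi(u_k)-1$ neighbors in $\{u_j: j\in[k+1,p]\}$ in the induced subgraph $G[U]$. Then $G[I,U]$ admits a $(\phi,U)$-well subgraph, i.e., a subgraph $F$ of $G[I,U]$ in which every vertex of $U$ has degree exactly $1$ in $F$ and every vertex $x\in V(F)\setminus U$ satisfies $d_F(x)\le\phi(x)$.
   Context: For integers $k\le l$, $[k,l]=\{k,k+1,\dots,l\}$. For disjoint $X,Y\subseteq V$, $G[X,Y]$ denotes the bipartite subgraph of $G$ with vertex set $X\cup Y$ whose edges are all edges of $G$ with one endpoint in $X$ and the other in $Y$. Given a vertex coloring $\phi$ of $G$ with non-negative integers, an independent set $I$ of $G$ is called $\phi$-maximum if it maximizes $\sum_{v\in I}\phi(v)$ among all independent sets of $G$ and every vertex of $V\setminus I$ has a neighbor in $I$. In a bipartite graph with parts $W,U$, a $U$-star-covering is a subgraph $F$ covering each vertex of $U$ exactly once (each component of $F$ is a star in which every vertex of $U$ is a leaf); for a coloring $\phi$ with positive integers, such $F$ is a $(\phi,U)$-well subgraph if $d_F(x)\le\phi(x)$ for every vertex $x\in V(F)\setminus U$. -}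

module Defs where

open import Data.Nat using (ℕ; zero; suc; _+_; _∸_; _≤_; _<_; _<ᵇ_)
open import Data.Fin using (Fin; zero; suc; toℕ)
open import Data.Bool using (Bool; true; false; if_then_else_; _∧_)
open import Data.Product using (Σ; _×_; ∃; ∃-syntax)
open import Data.Sum using (_⊎_)
open import Relation.Binary.PropositionalEquality using (_≡_)

record Graph (n : ℕ) : Set where
  field
    adj    : Fin n → Fin n → Bool
    adj-sym : ∀ x y → adj x y ≡ adj y x
    irrefl : ∀ x → adj x x ≡ false
open Graph public

sumF : ∀ {m} → (Fin m → ℕ) → ℕ
sumF {zero}  f = 0
sumF {suc m} f = f zero + sumF (λ i → f (suc i))

count : ∀ {m} → (Fin m → Bool) → ℕ
count b = sumF (λ i → if b i then 1 else 0)

HasEdge : ∀ {n} → Graph n → Set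
HasEdge G = ∃[ x ] ∃[ y ] (adj G x y ≡ true)

Independent : ∀ {n} → Graph n → (Fin n → Bool) → Set
Independent G S = ∀ x y → S x ≡ true → S y ≡ true → adj G x y ≡ false

weight : ∀ {n} → (Fin n → ℕ) → (Fin n → Bool) → ℕ
weight φ S = sumF (λ v → if S v then φ v else 0)

PhiMaximum : ∀ {n} → Graph n → (Fin n → ℕ) → (Fin n → Bool) → Set
PhiMaximum G φ I =
  Independent G I
  × (∀ J → Independent G J → weight φ J ≤ weight φ I)
  × (∀ v → I v ≡ false → ∃[ w ] (I w ≡ true × adj G v w ≡ true))

deg : ∀ {n} → (Fin n → Fin n → Bool) → Fin n → ℕ
deg F x = count (F x)

SubgraphIU : ∀ {n} → Graph n → (Fin n → Bool) → (Fin n → Fin n → Bool) → Set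
SubgraphIU G I F =
  (∀ x y → F x y ≡ F y x)
  × (∀ x y → F x y ≡ true →
       adj G x y ≡ true
       × ((I x ≡ true × I y ≡ false) ⊎ (I x ≡ false × I y ≡ true)))

-- (φ,U)-well subgraph of G[I,U]: a U-star-covering (each vertex of U has
-- degree exactly 1) with d_F(x) ≤ φ(x) for every other vertex of F
-- (vertices of I; those not in V(F) have degree 0).
WellSubgraph : ∀ {n} → Graph n → (Fin n → ℕ) → (Fin n → Bool) → (Fin n → Fin n → Bool) → Set
WellSubgraph G φ I F =
  SubgraphIU G I F
  × (∀ u → I u ≡ false → deg F u ≡ 1)
  × (∀ x → I x ≡ true → deg F x ≤ φ x)

-- Give each x ∈ I the capacity φ(x). A (φ,U)-well subgraph is then an assignment of every u ∈ U to
-- a neighbour in I that sends at most φ(x) vertices to each x, which by Hall's theorem with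
-- capacities (proved by Rado's edge-removal argument) exists as soon as |S| ≤ φ(N(S) ∩ I) for all
-- S ⊆ U. Scanning S in the order u₁, …, u_p and keeping each vertex not yet discarded while
-- discarding its later neighbours gives an independent T ⊆ S with |S| ≤ φ(T), since u_k discards at
-- most φ(u_k) − 1 vertices. Replacing I ∩ N(T) by T in I yields an independent set, so maximality
-- of I gives φ(T) ≤ φ(I ∩ N(T)) ≤ φ(N(S) ∩ I).
module Submission where

open import Defs
open import Data.Nat using (ℕ; zero; suc; _+_; _∸_; _≤_; _<_; _<ᵇ_; z≤n; s≤s)
open import Data.Nat.Properties hiding (suc-injective; _≟_)
open import Data.Nat.Induction using (<-wellFounded)
open import Data.Fin using (Fin; zero; suc; toℕ; _≟_)
open import Data.Fin.Properties using (any?; toℕ<n; suc-injective)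
open import Data.Fin.Subset.Properties using (anySubset?)
open import Data.Bool using (Bool; true; false; _∧_; _∨_; not; if_then_else_) renaming (_≟_ to _≟ᵇ_)
open import Data.Bool.Properties using (∨-comm; ∨-zeroʳ; ∧-zeroʳ; not-¬; ¬-not; T-≡)
open import Data.Vec using (lookup; tabulate)
open import Data.Vec.Properties using (lookup∘tabulate)
open import Data.Vec.Functional using (_∷_)
open import Data.Product using (Σ-syntax; _×_; _,_; proj₁; proj₂; ∃; ∃-syntax)
open import Data.Sum using (_⊎_; inj₁; inj₂)
open import Data.Empty using (⊥; ⊥-elim)
open import Function using (_∘_)
open import Level using (0ℓ)
open import Function.Definitions using (Injective)
open import Induction.WellFounded using (module All)
import Relation.Binary.Construct.On as On
open import Relation.Nullary using (¬_; Dec; yes; no; does; ¬?; _×-dec_)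
open import Relation.Nullary.Decidable using (dec-true; dec-false; decidable-stable; does-⇔)
open import Function.Bundles using (mk⇔; Equivalence)
open import Relation.Binary.PropositionalEquality using (_≡_; _≢_; refl; sym; trans; cong; cong₂; subst; subst₂; module ≡-Reasoning)
open import Algebra.Properties.CommutativeSemigroup +-commutativeSemigroup using (interchange)

∧-true⇒ : ∀ {a b} → a ∧ b ≡ true → a ≡ true × b ≡ true
∧-true⇒ {true} {true} _ = refl , refl

∧-true⇐ : ∀ {a b} → a ≡ true → b ≡ true → a ∧ b ≡ true
∧-true⇐ refl refl = refl

∨-true⇒ : ∀ {a b} → a ∨ b ≡ true → a ≡ true ⊎ b ≡ true
∨-true⇒ {true} _ = inj₁ refl
∨-true⇒ {false} b = inj₂ b

∨-trueˡ : ∀ {a} b → a ≡ true → a ∨ b ≡ true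
∨-trueˡ _ refl = refl

∨-trueʳ : ∀ a {b} → b ≡ true → a ∨ b ≡ true
∨-trueʳ a refl = ∨-zeroʳ a

not-true⇒ : ∀ {a} → not a ≡ true → a ≡ false
not-true⇒ {false} _ = refl

sumF-cong : ∀ {m} {f g : Fin m → ℕ} → (∀ i → f i ≡ g i) → sumF f ≡ sumF g
sumF-cong {zero}  eq = refl
sumF-cong {suc m} eq = cong₂ _+_ (eq zero) (sumF-cong (eq ∘ suc))

sumF-mono : ∀ {m} {f g : Fin m → ℕ} → (∀ i → f i ≤ g i) → sumF f ≤ sumF g
sumF-mono {zero}  le = z≤n
sumF-mono {suc m} le = +-mono-≤ (le zero) (sumF-mono (le ∘ suc))

sumF-mono-< : ∀ {m} {f g : Fin m → ℕ} → (∀ i → f i ≤ g i) → ∀ k → f k < g k → sumF f < sumF g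
sumF-mono-< le zero    lt = +-mono-<-≤ lt (sumF-mono (le ∘ suc))
sumF-mono-< le (suc k) lt = +-mono-≤-< (le zero) (sumF-mono-< (le ∘ suc) k lt)

sumF-+ : ∀ {m} (f g : Fin m → ℕ) → sumF (λ i → f i + g i) ≡ sumF f + sumF g
sumF-+ {zero}  f g = refl
sumF-+ {suc m} f g = begin
  (f zero + g zero) + sumF (λ i → f (suc i) + g (suc i))
    ≡⟨ cong ((f zero + g zero) +_) (sumF-+ (f ∘ suc) (g ∘ suc)) ⟩
  (f zero + g zero) + (sumF (f ∘ suc) + sumF (g ∘ suc))
    ≡⟨ interchange (f zero) (g zero) _ _ ⟩
  (f zero + sumF (f ∘ suc)) + (g zero + sumF (g ∘ suc)) ∎
  where open ≡-Reasoning

sumF-zero : ∀ {m} {f : Fin m → ℕ} → (∀ i → f i ≡ 0) → sumF f ≡ 0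
sumF-zero {zero}  eq = refl
sumF-zero {suc m} eq rewrite eq zero = sumF-zero (eq ∘ suc)

sumF-comm : ∀ {m m′} (f : Fin m → Fin m′ → ℕ) →
            sumF (λ i → sumF (f i)) ≡ sumF (λ j → sumF (λ i → f i j))
sumF-comm {zero} {m′} f = sym (sumF-zero {m′} (λ _ → refl))
sumF-comm {suc m} f = begin
  sumF (f zero) + sumF (λ i → sumF (f (suc i)))
    ≡⟨ cong (sumF (f zero) +_) (sumF-comm (f ∘ suc)) ⟩
  sumF (f zero) + sumF (λ j → sumF (λ i → f (suc i) j))
    ≡⟨ sym (sumF-+ (f zero) _) ⟩
  sumF (λ j → f zero j + sumF (λ i → f (suc i) j)) ∎
  where open ≡-Reasoning

sumF-single : ∀ {m} (f : Fin m → ℕ) k → (∀ i → i ≢ k → f i ≡ 0) → sumF f ≡ f k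
sumF-single f zero    eq = trans (cong (f zero +_) (sumF-zero (λ i → eq (suc i) λ ()))) (+-identityʳ _)
sumF-single f (suc k) eq = trans (cong (_+ sumF (f ∘ suc)) (eq zero λ ()))
                                 (sumF-single (f ∘ suc) k (λ i i≢k → eq (suc i) (i≢k ∘ suc-injective)))

term≤sumF : ∀ {m} (f : Fin m → ℕ) k → f k ≤ sumF f
term≤sumF f zero    = m≤m+n _ _
term≤sumF f (suc k) = m≤n⇒m≤o+n (f zero) (term≤sumF (f ∘ suc) k)

sumF-pos : ∀ {m} (f : Fin m → ℕ) → 0 < sumF f → ∃[ k ] 0 < f k
sumF-pos {suc m} f pos with f zero in eq
... | suc _ = zero , subst (0 <_) (sym eq) (s≤s z≤n)
... | zero  = let k , fk = sumF-pos (f ∘ suc) pos in suc k , fk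

_==_ : ∀ {m} → Fin m → Fin m → Bool
x == y = does (x ≟ y)

==-refl : ∀ {m} (x : Fin m) → x == x ≡ true
==-refl x = dec-true (x ≟ x) refl

==⇒≡ : ∀ {m} {x y : Fin m} → x == y ≡ true → x ≡ y
==⇒≡ {x = x} {y} eq with x ≟ y
... | yes x≡y = x≡y

≢⇒==-false : ∀ {m} {x y : Fin m} → x ≢ y → x == y ≡ false
≢⇒==-false {x = x} {y} = dec-false (x ≟ y)

==-false⇒≢ : ∀ {m} {x y : Fin m} → x == y ≡ false → x ≢ y
==-false⇒≢ {x = x} x==y refl = not-¬ (==-refl x) x==y

anyᶠ : ∀ {m} → (Fin m → Bool) → Bool
anyᶠ b = does (any? (λ i → b i ≟ᵇ true))

anyᶠ-intro : ∀ {m} (b : Fin m → Bool) {i} → b i ≡ true → anyᶠ b ≡ true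
anyᶠ-intro b {i} bi = dec-true (any? (λ i → b i ≟ᵇ true)) (i , bi)

anyᶠ-elim : ∀ {m} (b : Fin m → Bool) → anyᶠ b ≡ true → ∃[ i ] b i ≡ true
anyᶠ-elim b eq with any? (λ i → b i ≟ᵇ true)
... | yes witness = witness

anyᶠ-cong : ∀ {m} {b b′ : Fin m → Bool} → (∀ i → b i ≡ b′ i) → anyᶠ b ≡ anyᶠ b′
anyᶠ-cong {b = b} {b′} eq =
  does-⇔ (mk⇔ (λ (i , bi) → i , trans (sym (eq i)) bi) (λ (i , bi) → i , trans (eq i) bi))
         (any? (λ i → b i ≟ᵇ true)) (any? (λ i → b′ i ≟ᵇ true))

_⊆_ : ∀ {m} → (Fin m → Bool) → (Fin m → Bool) → Set
S ⊆ S′ = ∀ x → S x ≡ true → S′ x ≡ true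

_─_ : ∀ {m} → (Fin m → Bool) → Fin m → Fin m → Bool
(S ─ x) y = S y ∧ not (y == x)

module _ {m} (w : Fin m → ℕ) where

  restrict : (Fin m → Bool) → Fin m → ℕ
  restrict S x = if S x then w x else 0

  weight-cong : ∀ {S S′} → (∀ x → S x ≡ S′ x) → weight w S ≡ weight w S′
  weight-cong eq = sumF-cong (λ x → cong (λ b → if b then w x else 0) (eq x))

  restrict-mono : ∀ {S S′} → S ⊆ S′ → ∀ x → restrict S x ≤ restrict S′ x
  restrict-mono {S} {S′} S⊆S′ x with S x in Sx
  ... | false = z≤n
  ... | true rewrite S⊆S′ x Sx = ≤-refl

  weight-mono : ∀ {S S′} → S ⊆ S′ → weight w S ≤ weight w S′
  weight-mono S⊆S′ = sumF-mono (restrict-mono S⊆S′)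

  weight-mono-< : ∀ {S S′ x} → S ⊆ S′ → S x ≡ false → S′ x ≡ true → 0 < w x → weight w S < weight w S′
  weight-mono-< {S} {S′} {x} S⊆S′ Sx S′x pos = sumF-mono-< (restrict-mono S⊆S′) x
    (subst₂ _<_ (cong (λ b → if b then w x else 0) (sym Sx)) (cong (λ b → if b then w x else 0) (sym S′x)) pos)

  weight-empty : ∀ {S} → (∀ x → S x ≡ false) → weight w S ≡ 0
  weight-empty S-empty = sumF-zero (λ x → cong (λ b → if b then w x else 0) (S-empty x))

  weight-split : (S A : Fin m → Bool) → weight w S ≡ weight w (λ x → S x ∧ A x) + weight w (λ x → S x ∧ not (A x))
  weight-split S A = trans (sumF-cong pointwise) (sumF-+ (restrict (λ x → S x ∧ A x)) (restrict (λ x → S x ∧ not (A x))))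
    where
    pointwise : ∀ x → (if S x then w x else 0)
                      ≡ (if S x ∧ A x then w x else 0) + (if S x ∧ not (A x) then w x else 0)
    pointwise x with S x | A x
    ... | true  | true  = sym (+-identityʳ (w x))
    ... | true  | false = refl
    ... | false | _     = refl

  weight-∨-∧ : (S S′ : Fin m → Bool) → weight w (λ x → S x ∨ S′ x) + weight w (λ x → S x ∧ S′ x) ≡ weight w S + weight w S′
  weight-∨-∧ S S′ = trans (sym (sumF-+ (restrict (λ x → S x ∨ S′ x)) (restrict (λ x → S x ∧ S′ x))))
                      (trans (sumF-cong pointwise) (sumF-+ (restrict S) (restrict S′)))
    where
    pointwise : ∀ x → (if S x ∨ S′ x then w x else 0) + (if S x ∧ S′ x then w x else 0)
                      ≡ (if S x then w x else 0) + (if S′ x then w x else 0)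
    pointwise x with S x | S′ x
    ... | true  | true  = refl
    ... | true  | false = refl
    ... | false | true  = +-comm (w x) 0
    ... | false | false = refl

  weight-singleton : ∀ {S} y → S y ≡ true → (∀ z → z ≢ y → S z ≡ false) → weight w S ≡ w y
  weight-singleton {S} y Sy others =
    trans (sumF-single _ y (λ z z≢y → cong (λ b → if b then w z else 0) (others z z≢y)))
          (cong (λ b → if b then w y else 0) Sy)

  weight-remove : ∀ S {x} → S x ≡ true → weight w S ≡ w x + weight w (S ─ x)
  weight-remove S {x} Sx = trans (weight-split S (_== x)) (cong (_+ weight w (S ─ x)) at-x)
    where
    at-x : weight w (λ y → S y ∧ (y == x)) ≡ w x
    at-x = weight-singleton x (∧-true⇐ Sx (==-refl x))
             (λ z z≢x → trans (cong (S z ∧_) (≢⇒==-false z≢x)) (∧-zeroʳ (S z)))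

  weight-≤-point : ∀ {S} y → (∀ z → S z ≡ true → z ≡ y) → weight w S ≤ w y
  weight-≤-point {S} y only-y = begin
    weight w S           ≤⟨ weight-mono (λ z Sz → subst (λ v → z == v ≡ true) (only-y z Sz) (==-refl z)) ⟩
    weight w (_== y)     ≡⟨ weight-singleton y (==-refl y) (λ z → ≢⇒==-false) ⟩
    w y                  ∎
    where open ≤-Reasoning

  selected≤weight : ∀ S x → S x ≡ true → w x ≤ weight w S
  selected≤weight S x Sx = ≤-trans (≤-reflexive (cong (λ b → if b then w x else 0) (sym Sx))) (term≤sumF (restrict S) x)

  weight-pos : (S : Fin m → Bool) → 0 < weight w S → ∃[ x ] S x ≡ true
  weight-pos S pos = let x , term-pos = sumF-pos _ pos in x , selected (S x) term-pos
    where
    selected : ∀ b {a} → 0 < (if b then a else 0) → b ≡ true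
    selected true _ = refl

count-≡1 : ∀ {m} (S : Fin m → Bool) x → S x ≡ true → (∀ z → S z ≡ true → z ≡ x) → count S ≡ 1
count-≡1 S x Sx only-x = weight-singleton (λ _ → 1) x Sx (λ z z≢x → ¬-not (λ Sz → z≢x (only-x z Sz)))

neighbours : ∀ {m n} → (Fin m → Fin n → Bool) → (Fin m → Bool) → Fin n → Bool
neighbours E S y = anyᶠ (λ i → S i ∧ E i y)

neighbours-intro : ∀ {m n} (E : Fin m → Fin n → Bool) S {i y} → S i ≡ true → E i y ≡ true → neighbours E S y ≡ true
neighbours-intro E S {y = y} Si Eiy = anyᶠ-intro (λ i → S i ∧ E i y) (∧-true⇐ Si Eiy)

neighbours-elim : ∀ {m n} (E : Fin m → Fin n → Bool) {S y} → neighbours E S y ≡ true → ∃[ i ] S i ≡ true × E i y ≡ true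
neighbours-elim E {S} {y} hit = let i , hitᵢ = anyᶠ-elim (λ i → S i ∧ E i y) hit in i , ∧-true⇒ hitᵢ

module _ {p n} (u : Fin p → Fin n) where

  image : (Fin p → Bool) → Fin n → Bool
  image = neighbours (λ k → u k ==_)

  fibre-sum : (w : Fin n → ℕ) (B : Fin p → Bool) →
              sumF (λ x → sumF (λ k → if B k ∧ u k == x then w x else 0)) ≡ weight (w ∘ u) B
  fibre-sum w B = trans (sumF-comm (λ x k → if B k ∧ u k == x then w x else 0)) (sumF-cong fibre)
    where
    fibre : ∀ k → sumF (λ x → if B k ∧ u k == x then w x else 0) ≡ (if B k then w (u k) else 0)
    fibre k with B k
    ... | false = sumF-zero {n} (λ _ → refl)
    ... | true  = weight-singleton w (u k) (==-refl (u k)) (λ x x≢uk → ≢⇒==-false (x≢uk ∘ sym))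

  weight-≤-preimage : (w : Fin n → ℕ) (B : Fin n → Bool) (B′ : Fin p → Bool) →
                      (∀ x → B x ≡ true → ∃[ k ] u k ≡ x × B′ k ≡ true) → weight w B ≤ weight (w ∘ u) B′
  weight-≤-preimage w B B′ covered = ≤-trans (sumF-mono pointwise) (≤-reflexive (fibre-sum w B′))
    where
    pointwise : ∀ x → (if B x then w x else 0) ≤ sumF (λ k → if B′ k ∧ u k == x then w x else 0)
    pointwise x with B x in Bx
    ... | false = z≤n
    ... | true  with covered x Bx
    ...   | k , refl , B′k = selected≤weight (λ _ → w (u k)) (λ j → B′ j ∧ u j == u k) k (∧-true⇐ B′k (==-refl (u k)))

  weight-≤-image : Injective _≡_ _≡_ u → (w : Fin n → ℕ) (T : Fin p → Bool) → weight (w ∘ u) T ≤ weight w (image T)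
  weight-≤-image u-inj w T = ≤-trans (≤-reflexive (sym (fibre-sum w T))) (sumF-mono pointwise)
    where
    pointwise : ∀ x → weight (λ _ → w x) (λ k → T k ∧ u k == x) ≤ (if image T x then w x else 0)
    pointwise x with any? (λ k → (T k ∧ u k == x) ≟ᵇ true)
    ... | yes (k , hit) = weight-≤-point (λ _ → w x) k (λ j hit′ → u-inj (trans (onto-x hit′) (sym (onto-x hit))))
      where
      onto-x : ∀ {j} → T j ∧ u j == x ≡ true → u j ≡ x
      onto-x = ==⇒≡ ∘ proj₂ ∘ ∧-true⇒
    ... | no miss = ≤-reflexive (weight-empty (λ _ → w x) (λ k → ¬-not (λ hit → miss (k , hit))))

module CapacitatedHall {m n : ℕ} (c : Fin n → ℕ) where

  capacity : (Fin m → Fin n → Bool) → (Fin m → Bool) → ℕ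
  capacity E S = weight c (neighbours E S)

  HallCondition : (Fin m → Fin n → Bool) → Set
  HallCondition E = ∀ S → count S ≤ capacity E S

  Deficient : (Fin m → Fin n → Bool) → (Fin m → Bool) → Set
  Deficient E S = capacity E S < count S

  Assignment : (Fin m → Fin n → Bool) → Set
  Assignment E = Σ[ f ∈ (Fin m → Fin n) ] (∀ i → E i (f i) ≡ true) × (∀ y → count (λ i → f i == y) ≤ c y)

  deficient-cong : ∀ E {S S′} → (∀ i → S i ≡ S′ i) → Deficient E S → Deficient E S′
  deficient-cong E eq = subst₂ _<_ (weight-cong c (λ y → anyᶠ-cong (λ i → cong (_∧ E i y) (eq i)))) (weight-cong (λ _ → 1) eq)

  hall-or-deficient : ∀ E → HallCondition E ⊎ ∃ (Deficient E)
  hall-or-deficient E with anySubset? (λ V → capacity E (lookup V) <? count (lookup V))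
  ... | yes (V , deficient) = inj₂ (lookup V , deficient)
  ... | no none = inj₁ (λ S → ≮⇒≥ (λ deficient →
                    none (tabulate S , deficient-cong E (λ i → sym (lookup∘tabulate S i)) deficient)))

  assignment-of-unique-neighbours : ∀ E → HallCondition E → (∀ i {y z} → E i y ≡ true → E i z ≡ true → y ≡ z) → Assignment E
  assignment-of-unique-neighbours E hall unique = f , f-edge , load
    where
    neighbour : ∀ i → ∃[ y ] E i y ≡ true
    neighbour i with weight-pos c _ (≤-trans (selected≤weight (λ _ → 1) (_== i) i (==-refl i)) (hall (_== i)))
    ... | y , hit with neighbours-elim E hit
    ...   | j , j==i , Ejy = y , subst (λ k → E k y ≡ true) (==⇒≡ j==i) Ejy

    f : Fin m → Fin n
    f i = proj₁ (neighbour i)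

    f-edge : ∀ i → E i (f i) ≡ true
    f-edge i = proj₂ (neighbour i)

    load : ∀ y → count (λ i → f i == y) ≤ c y
    load y = ≤-trans (hall (λ i → f i == y)) (weight-≤-point c y only-y)
      where
      only-y : ∀ z → neighbours E (λ i → f i == y) z ≡ true → z ≡ y
      only-y z hit with neighbours-elim E hit
      ... | i , fi==y , Eiz = trans (unique i Eiz (f-edge i)) (==⇒≡ fi==y)

  removeEdge : Fin m → Fin n → (Fin m → Fin n → Bool) → Fin m → Fin n → Bool
  removeEdge i y E j z = E j z ∧ not (j == i ∧ z == y)

  removeEdge-⊆ : ∀ {i y} E j → removeEdge i y E j ⊆ E j
  removeEdge-⊆ E j z = proj₁ ∘ ∧-true⇒

  removeEdge-keeps : ∀ {i y} E {j z} → j ≢ i ⊎ z ≢ y → E j z ≡ true → removeEdge i y E j z ≡ true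
  removeEdge-keeps {i} {y} E {j} {z} other Ejz = ∧-true⇐ Ejz (cong not (untouched other))
    where
    untouched : j ≢ i ⊎ z ≢ y → (j == i ∧ z == y) ≡ false
    untouched (inj₁ j≢i) rewrite ≢⇒==-false j≢i = refl
    untouched (inj₂ z≢y) rewrite ≢⇒==-false z≢y = ∧-zeroʳ (j == i)

  edges : (Fin m → Fin n → Bool) → ℕ
  edges E = sumF (λ i → count (E i))

  edges-removeEdge : ∀ {E i y} → E i y ≡ true → edges (removeEdge i y E) < edges E
  edges-removeEdge {E} {i} {y} Eiy =
    sumF-mono-< (λ j → weight-mono (λ _ → 1) (removeEdge-⊆ E j)) i
                (weight-mono-< (λ _ → 1) (removeEdge-⊆ E i) removed Eiy (s≤s z≤n))
    where
    removed : removeEdge i y E i y ≡ false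
    removed rewrite ==-refl i | ==-refl y = ∧-zeroʳ (E i y)

  assignment-⊆ : ∀ {E E′} → (∀ j → E′ j ⊆ E j) → Assignment E′ → Assignment E
  assignment-⊆ E′⊆E (f , f-edge , load) = f , (λ i → E′⊆E i (f i) (f-edge i)) , load

  deficient-contains : ∀ {E i y S} → HallCondition E → Deficient (removeEdge i y E) S → S i ≡ true
  deficient-contains {E} {i} {y} {S} hall deficient with S i in Si
  ... | true  = refl
  ... | false = ⊥-elim (<⇒≱ deficient (≤-trans (hall S) (weight-mono c kept)))
    where
    kept : neighbours E S ⊆ neighbours (removeEdge i y E) S
    kept z hit with neighbours-elim E hit
    ... | j , Sj , Ejz = neighbours-intro (removeEdge i y E) S Sj (removeEdge-keeps E (inj₁ (λ { refl → not-¬ Sj Si })) Ejz)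

  neighbours-∪-removeEdge : ∀ {E i y₁ y₂ S₁ S₂} → y₁ ≢ y₂ → S₁ i ≡ true → S₂ i ≡ true →
                            neighbours E (λ j → S₁ j ∨ S₂ j)
                              ⊆ (λ z → neighbours (removeEdge i y₁ E) S₁ z ∨ neighbours (removeEdge i y₂ E) S₂ z)
  neighbours-∪-removeEdge {E} {i} {y₁} {y₂} {S₁} {S₂} y₁≢y₂ S₁i S₂i z hit =
    let j , S₁₂j , Ejz = neighbours-elim E hit in survives (j ≟ i) (z ≟ y₁) S₁₂j Ejz
    where
    survives : ∀ {j} → Dec (j ≡ i) → Dec (z ≡ y₁) → S₁ j ∨ S₂ j ≡ true → E j z ≡ true →
               neighbours (removeEdge i y₁ E) S₁ z ∨ neighbours (removeEdge i y₂ E) S₂ z ≡ true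
    survives {j} (no j≢i) _ S₁₂j Ejz with ∨-true⇒ {S₁ j} S₁₂j
    ... | inj₁ S₁j = ∨-trueˡ _ (neighbours-intro (removeEdge i y₁ E) S₁ S₁j (removeEdge-keeps E (inj₁ j≢i) Ejz))
    ... | inj₂ S₂j = ∨-trueʳ _ (neighbours-intro (removeEdge i y₂ E) S₂ S₂j (removeEdge-keeps E (inj₁ j≢i) Ejz))
    survives (yes refl) (yes refl) _ Ejz = ∨-trueʳ _ (neighbours-intro (removeEdge i y₂ E) S₂ S₂i (removeEdge-keeps E (inj₂ y₁≢y₂) Ejz))
    survives (yes refl) (no z≢y₁)  _ Ejz = ∨-trueˡ _ (neighbours-intro (removeEdge i y₁ E) S₁ S₁i (removeEdge-keeps E (inj₂ z≢y₁) Ejz))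

  neighbours-∩-removeEdge : ∀ {E i y₁ y₂ S₁ S₂} →
                            neighbours E ((λ j → S₁ j ∧ S₂ j) ─ i)
                              ⊆ (λ z → neighbours (removeEdge i y₁ E) S₁ z ∧ neighbours (removeEdge i y₂ E) S₂ z)
  neighbours-∩-removeEdge {E} {i} {y₁} {y₂} {S₁} {S₂} z hit =
    let j , Rj , Ejz = neighbours-elim E hit
        S₁₂j , j≠i = ∧-true⇒ Rj
        S₁j , S₂j = ∧-true⇒ S₁₂j
        j≢i = ==-false⇒≢ (not-true⇒ j≠i)
    in ∧-true⇐ (neighbours-intro (removeEdge i y₁ E) S₁ S₁j (removeEdge-keeps E (inj₁ j≢i) Ejz))
               (neighbours-intro (removeEdge i y₂ E) S₂ S₂j (removeEdge-keeps E (inj₁ j≢i) Ejz))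

  -- Rado's argument: by submodularity of the capacity, S₁ ∪ S₂ and (S₁ ∩ S₂) ─ i would together
  -- violate the Hall condition for E.
  no-two-deficient : ∀ {E i y₁ y₂ S₁ S₂} → HallCondition E → y₁ ≢ y₂ →
                     Deficient (removeEdge i y₁ E) S₁ → Deficient (removeEdge i y₂ E) S₂ → ⊥
  no-two-deficient {E} {i} {y₁} {y₂} {S₁} {S₂} hall y₁≢y₂ deficient₁ deficient₂ = <-irrefl refl (begin-strict
    suc (capacity E₁ S₁) + capacity E₂ S₂
      <⟨ +-mono-≤-< deficient₁ deficient₂ ⟩
    count S₁ + count S₂
      ≡⟨ weight-∨-∧ (λ _ → 1) S₁ S₂ ⟨
    count U + count (λ j → S₁ j ∧ S₂ j)
      ≡⟨ cong (count U +_) (weight-remove (λ _ → 1) (λ j → S₁ j ∧ S₂ j) (∧-true⇐ S₁i S₂i)) ⟩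
    count U + suc (count R)
      ≤⟨ +-mono-≤ (≤-trans (hall U) (weight-mono c (neighbours-∪-removeEdge {E} {i} {y₁} {y₂} {S₁} {S₂} y₁≢y₂ S₁i S₂i)))
                  (s≤s (≤-trans (hall R) (weight-mono c (neighbours-∩-removeEdge {E} {i} {y₁} {y₂} {S₁} {S₂})))) ⟩
    weight c (λ z → N₁ z ∨ N₂ z) + suc (weight c (λ z → N₁ z ∧ N₂ z))
      ≡⟨ +-suc _ _ ⟩
    suc (weight c (λ z → N₁ z ∨ N₂ z) + weight c (λ z → N₁ z ∧ N₂ z))
      ≡⟨ cong suc (weight-∨-∧ c N₁ N₂) ⟩
    suc (capacity E₁ S₁ + capacity E₂ S₂) ∎)
    where
    open ≤-Reasoning
    E₁ E₂ : Fin m → Fin n → Bool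
    E₁ = removeEdge i y₁ E
    E₂ = removeEdge i y₂ E
    N₁ N₂ : Fin n → Bool
    N₁ = neighbours E₁ S₁
    N₂ = neighbours E₂ S₂
    U R : Fin m → Bool
    U j = S₁ j ∨ S₂ j
    R = (λ j → S₁ j ∧ S₂ j) ─ i
    S₁i = deficient-contains hall deficient₁
    S₂i = deficient-contains hall deficient₂

  hall-after-removal : ∀ {E i y₁ y₂} → HallCondition E → y₁ ≢ y₂ →
                       HallCondition (removeEdge i y₁ E) ⊎ HallCondition (removeEdge i y₂ E)
  hall-after-removal {E} {i} {y₁} {y₂} hall y₁≢y₂
    with hall-or-deficient (removeEdge i y₁ E) | hall-or-deficient (removeEdge i y₂ E)
  ... | inj₁ hall₁ | _ = inj₁ hall₁
  ... | inj₂ _ | inj₁ hall₂ = inj₂ hall₂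
  ... | inj₂ (_ , deficient₁) | inj₂ (_ , deficient₂) = ⊥-elim (no-two-deficient hall y₁≢y₂ deficient₁ deficient₂)

  hall-assignment : ∀ E → HallCondition E → Assignment E
  hall-assignment = All.wfRec (On.wellFounded edges <-wellFounded) 0ℓ (λ E → HallCondition E → Assignment E) step
    where
    step : ∀ E → (∀ {E′} → edges E′ < edges E → HallCondition E′ → Assignment E′) → HallCondition E → Assignment E
    step E recurse hall
      with any? (λ i → any? (λ y → any? (λ z → ¬? (y ≟ z) ×-dec E i y ≟ᵇ true ×-dec E i z ≟ᵇ true)))
    ... | no none = assignment-of-unique-neighbours E hall
          (λ i {y} {z} Eiy Eiz → decidable-stable (y ≟ z) (λ y≢z → none (i , y , z , y≢z , Eiy , Eiz)))
    ... | yes (i , y₁ , y₂ , y₁≢y₂ , Eiy₁ , Eiy₂) with hall-after-removal {i = i} hall y₁≢y₂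
    ...   | inj₁ hall₁ = assignment-⊆ (removeEdge-⊆ E) (recurse (edges-removeEdge Eiy₁) hall₁)
    ...   | inj₂ hall₂ = assignment-⊆ (removeEdge-⊆ E) (recurse (edges-removeEdge Eiy₂) hall₂)

pullback : ∀ {m n} → Graph n → (Fin m → Fin n) → Graph m
pullback G u = record
  { adj     = λ j k → adj G (u j) (u k)
  ; adj-sym = λ j k → adj-sym G (u j) (u k)
  ; irrefl  = irrefl G ∘ u
  }

forwardNeighbours : ∀ {p} → Graph p → Fin p → Fin p → Bool
forwardNeighbours H k j = (toℕ k <ᵇ toℕ j) ∧ adj H k j

forwardNeighbours-last : ∀ {p} (H : Graph p) k → ¬ suc (toℕ k) < p → count (forwardNeighbours H k) ≡ 0
forwardNeighbours-last {p} H k last = weight-empty (λ _ → 1) (λ j → ¬-not (λ forward →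
  last (≤-trans (s≤s (<ᵇ⇒< (toℕ k) (toℕ j) (Equivalence.from T-≡ (proj₁ (∧-true⇒ forward))))) (toℕ<n j))))

greedy-independent : ∀ {p} (H : Graph p) (ψ : Fin p → ℕ) → (∀ k → 0 < ψ k) →
                     (∀ k → count (forwardNeighbours H k) ≤ ψ k ∸ 1) →
                     ∀ S → ∃[ T ] T ⊆ S × Independent H T × count S ≤ weight ψ T
greedy-independent {zero}  H ψ ψ-pos forward S = (λ ()) , (λ ()) , (λ ()) , z≤n
greedy-independent {suc p} H ψ ψ-pos forward S = choose (S zero) refl
  where
  -- forward ∘ suc typechecks as is: toℕ (suc k) <ᵇ 0 reduces to false and suc a <ᵇ suc b to a <ᵇ b.
  later : ∀ S′ → ∃[ T ] T ⊆ S′ × Independent (pullback H suc) T × count S′ ≤ weight (ψ ∘ suc) T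
  later = greedy-independent (pullback H suc) (ψ ∘ suc) (ψ-pos ∘ suc) (forward ∘ suc)

  choose : ∀ b → S zero ≡ b → ∃[ T ] T ⊆ S × Independent H T × count S ≤ weight ψ T
  choose false S₀ with later (S ∘ suc)
  ... | T , T⊆S , T-ind , bound = false ∷ T , ⊆ , independent , count-bound
    where
    count-bound : count S ≤ weight (ψ ∘ suc) T
    count-bound = subst (λ b → (if b then 1 else 0) + count (S ∘ suc) ≤ weight (ψ ∘ suc) T) (sym S₀) bound

    ⊆ : (false ∷ T) ⊆ S
    ⊆ (suc j) Tj = T⊆S j Tj

    independent : Independent H (false ∷ T)
    independent (suc j) (suc k) Tj Tk = T-ind j k Tj Tk

  choose true S₀ with later (λ j → S (suc j) ∧ not (adj H zero (suc j)))
  ... | T , T⊆S′ , T-ind , bound = true ∷ T , ⊆ , independent , count-bound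
    where
    ⊆ : (true ∷ T) ⊆ S
    ⊆ zero    _  = S₀
    ⊆ (suc j) Tj = proj₁ (∧-true⇒ (T⊆S′ j Tj))

    independent : Independent H (true ∷ T)
    independent zero    zero    _  _  = irrefl H zero
    independent zero    (suc k) _  Tk = not-true⇒ (proj₂ (∧-true⇒ (T⊆S′ k Tk)))
    independent (suc j) zero    Tj T₀ = trans (adj-sym H (suc j) zero) (independent zero (suc j) T₀ Tj)
    independent (suc j) (suc k) Tj Tk = T-ind j k Tj Tk

    count-bound : count S ≤ ψ zero + weight (ψ ∘ suc) T
    count-bound = begin
      count S
        ≡⟨ cong (λ b → (if b then 1 else 0) + count (S ∘ suc)) S₀ ⟩
      1 + count (S ∘ suc)
        ≡⟨ cong suc (weight-split (λ _ → 1) (S ∘ suc) (adj H zero ∘ suc)) ⟩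
      1 + (count (λ j → S (suc j) ∧ adj H zero (suc j)) + count (λ j → S (suc j) ∧ not (adj H zero (suc j))))
        ≤⟨ s≤s (+-mono-≤ (≤-trans (weight-mono (λ _ → 1) {S′ = adj H zero ∘ suc} (λ j → proj₂ ∘ ∧-true⇒)) (forward zero)) bound) ⟩
      1 + ((ψ zero ∸ 1) + weight (ψ ∘ suc) T)
        ≡⟨ sym (+-assoc 1 (ψ zero ∸ 1) _) ⟩
      (1 + (ψ zero ∸ 1)) + weight (ψ ∘ suc) T
        ≡⟨ cong (_+ weight (ψ ∘ suc) T) (m+[n∸m]≡n (ψ-pos zero)) ⟩
      ψ zero + weight (ψ ∘ suc) T ∎
      where open ≤-Reasoning

exchange-identity : ∀ i a t w → (t ≡ true → i ≡ false) →
                    (if (i ∧ not a) ∨ t then w else 0) + (if i ∧ a then w else 0) ≡ (if i then w else 0) + (if t then w else 0)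
exchange-identity true  true  true  w disjoint = ⊥-elim (not-¬ (disjoint refl) refl)
exchange-identity true  false true  w disjoint = ⊥-elim (not-¬ (disjoint refl) refl)
exchange-identity true  true  false w disjoint = sym (+-identityʳ w)
exchange-identity true  false false w disjoint = refl
exchange-identity false a     true  w disjoint = +-identityʳ w
exchange-identity false a     false w disjoint = refl

exchange-bound : ∀ {n} (G : Graph n) (φ : Fin n → ℕ) (I T : Fin n → Bool) →
                 Independent G I → (∀ J → Independent G J → weight φ J ≤ weight φ I) →
                 Independent G T → (∀ x → T x ≡ true → I x ≡ false) →
                 weight φ T ≤ weight φ (λ x → I x ∧ neighbours (adj G) T x)
exchange-bound {n} G φ I T I-ind I-max T-ind disjoint =
  +-cancelˡ-≤ (weight φ I) _ _ (begin
    weight φ I + weight φ T  ≡⟨ sym exchange ⟩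
    weight φ J + weight φ X  ≤⟨ +-monoˡ-≤ (weight φ X) (I-max J J-ind) ⟩
    weight φ I + weight φ X  ∎)
  where
  open ≤-Reasoning
  N J X : Fin n → Bool
  N = neighbours (adj G) T
  J x = (I x ∧ not (N x)) ∨ T x
  X x = I x ∧ N x

  exchange : weight φ J + weight φ X ≡ weight φ I + weight φ T
  exchange = begin-equality
    weight φ J + weight φ X                       ≡⟨ sumF-+ (restrict φ J) (restrict φ X) ⟨
    sumF (λ x → restrict φ J x + restrict φ X x)  ≡⟨ sumF-cong (λ x → exchange-identity (I x) (N x) (T x) (φ x) (disjoint x)) ⟩
    sumF (λ x → restrict φ I x + restrict φ T x)  ≡⟨ sumF-+ (restrict φ I) (restrict φ T) ⟩
    weight φ I + weight φ T                       ∎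

  outside : ∀ {x y} → I x ∧ not (N x) ≡ true → T y ≡ true → adj G x y ≡ false
  outside {x} {y} I∖Nx Ty = ¬-not (λ adj-xy →
    not-¬ (neighbours-intro (adj G) T Ty (trans (adj-sym G y x) adj-xy)) (not-true⇒ (proj₂ (∧-true⇒ I∖Nx))))

  J-ind : Independent G J
  J-ind x y Jx Jy with ∨-true⇒ {I x ∧ not (N x)} Jx | ∨-true⇒ {I y ∧ not (N y)} Jy
  ... | inj₁ I∖Nx | inj₁ I∖Ny = I-ind x y (proj₁ (∧-true⇒ I∖Nx)) (proj₁ (∧-true⇒ I∖Ny))
  ... | inj₁ I∖Nx | inj₂ Ty   = outside I∖Nx Ty
  ... | inj₂ Tx   | inj₁ I∖Ny = trans (adj-sym G x y) (outside I∖Ny Tx)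
  ... | inj₂ Tx   | inj₂ Ty   = T-ind x y Tx Ty

module _ {n} (G : Graph n) (φ : Fin n → ℕ) (I : Fin n → Bool) {p} (u : Fin p → Fin n)
         (u-inj : Injective _≡_ _≡_ u) (u∉I : ∀ k → I (u k) ≡ false) where

  open CapacitatedHall {p} {n} φ

  edgesToI : Fin p → Fin n → Bool
  edgesToI k x = adj G (u k) x ∧ I x

  hall-condition : (∀ v → 0 < φ v) → Independent G I → (∀ J → Independent G J → weight φ J ≤ weight φ I) →
                   (∀ k → count (forwardNeighbours (pullback G u) k) ≤ φ (u k) ∸ 1) → HallCondition edgesToI
  hall-condition φ-pos I-ind I-max forward S
    with greedy-independent (pullback G u) (φ ∘ u) (φ-pos ∘ u) forward S
  ... | T , T⊆S , T-ind , S≤T = begin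
    count S                                                   ≤⟨ S≤T ⟩
    weight (φ ∘ u) T                                          ≤⟨ weight-≤-image u u-inj φ T ⟩
    weight φ (image u T)                                      ≤⟨ exchange-bound G φ I (image u T) I-ind I-max image-ind image-∉I ⟩
    weight φ (λ x → I x ∧ neighbours (adj G) (image u T) x)  ≤⟨ weight-mono φ covered ⟩
    capacity edgesToI S                                       ∎
    where
    open ≤-Reasoning
    image-elim : ∀ x → image u T x ≡ true → ∃[ k ] T k ≡ true × u k ≡ x
    image-elim x hit = let k , Tk , uk==x = neighbours-elim (λ k → u k ==_) hit in k , Tk , ==⇒≡ uk==x

    image-ind : Independent G (image u T)
    image-ind x y hit-x hit-y with image-elim x hit-x | image-elim y hit-y
    ... | j , Tj , refl | k , Tk , refl = T-ind j k Tj Tk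

    image-∉I : ∀ x → image u T x ≡ true → I x ≡ false
    image-∉I x hit with image-elim x hit
    ... | k , _ , refl = u∉I k

    covered : (λ x → I x ∧ neighbours (adj G) (image u T) x) ⊆ neighbours edgesToI S
    covered x hit with ∧-true⇒ hit
    ... | Ix , near with neighbours-elim (adj G) near
    ...   | y , hit-y , adj-yx with image-elim y hit-y
    ...     | k , Tk , refl = neighbours-intro edgesToI S (T⊆S k Tk) (∧-true⇐ adj-yx Ix)

  module _ (f : Fin p → Fin n) (f-edge : ∀ k → edgesToI k (f k) ≡ true) where

    assigned : Fin n → Fin n → Bool
    assigned x y = anyᶠ (λ k → u k == x ∧ f k == y)

    assigned-elim : ∀ {x y} → assigned x y ≡ true → ∃[ k ] u k ≡ x × f k ≡ y
    assigned-elim hit = let k , hitₖ = anyᶠ-elim _ hit ; ux , fy = ∧-true⇒ hitₖ in k , ==⇒≡ ux , ==⇒≡ fy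

    assigned-edge : ∀ {x y} → assigned x y ≡ true → adj G x y ≡ true × I x ≡ false × I y ≡ true
    assigned-edge hit with assigned-elim hit
    ... | k , refl , refl = let adj-k , I-fk = ∧-true⇒ (f-edge k) in adj-k , u∉I k , I-fk

    stars : Fin n → Fin n → Bool
    stars x y = assigned x y ∨ assigned y x

    stars-subgraph : SubgraphIU G I stars
    stars-subgraph = (λ x y → ∨-comm (assigned x y) (assigned y x)) , edge
      where
      edge : ∀ x y → stars x y ≡ true → adj G x y ≡ true × ((I x ≡ true × I y ≡ false) ⊎ (I x ≡ false × I y ≡ true))
      edge x y hit with ∨-true⇒ {assigned x y} hit
      ... | inj₁ xy = let adj-xy , Ix , Iy = assigned-edge xy in adj-xy , inj₂ (Ix , Iy)
      ... | inj₂ yx = let adj-yx , Iy , Ix = assigned-edge yx in trans (adj-sym G x y) adj-yx , inj₁ (Ix , Iy)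

    stars-deg-U : ∀ k → deg stars (u k) ≡ 1
    stars-deg-U k = count-≡1 (stars (u k)) (f k)
      (∨-trueˡ _ (anyᶠ-intro (λ j → u j == u k ∧ f j == f k) (∧-true⇐ (==-refl (u k)) (==-refl (f k)))))
      only-fk
      where
      only-fk : ∀ y → stars (u k) y ≡ true → y ≡ f k
      only-fk y hit with ∨-true⇒ {assigned (u k) y} hit
      ... | inj₁ ky = let j , uj≡uk , fj≡y = assigned-elim ky in trans (sym fj≡y) (cong f (u-inj uj≡uk))
      ... | inj₂ yk = let _ , _ , I-uk = assigned-edge yk in ⊥-elim (not-¬ I-uk (u∉I k))

    stars-deg-I : (∀ x → count (λ k → f k == x) ≤ φ x) → ∀ x → I x ≡ true → deg stars x ≤ φ x
    stars-deg-I load x Ix = ≤-trans (weight-≤-preimage u (λ _ → 1) (stars x) (λ k → f k == x) assigned-to-x) (load x)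
      where
      assigned-to-x : ∀ y → stars x y ≡ true → ∃[ k ] u k ≡ y × f k == x ≡ true
      assigned-to-x y hit with ∨-true⇒ {assigned x y} hit
      ... | inj₁ xy = let _ , I-x , _ = assigned-edge xy in ⊥-elim (not-¬ Ix I-x)
      ... | inj₂ yx = let k , uk≡y , fk≡x = assigned-elim yx in k , uk≡y , subst (λ z → f k == z ≡ true) fk≡x (==-refl (f k))

  well-subgraph : (∀ v → I v ≡ false → ∃[ k ] u k ≡ v) → Assignment edgesToI → ∃[ F ] WellSubgraph G φ I F
  well-subgraph onto (f , f-edge , load) =
    stars f f-edge , stars-subgraph f f-edge , deg-U , stars-deg-I f f-edge load
    where
    deg-U : ∀ v → I v ≡ false → deg (stars f f-edge) v ≡ 1
    deg-U v Iv with onto v Iv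
    ... | k , refl = stars-deg-U f f-edge k

lemma1 : ∀ {n} (G : Graph n) → HasEdge G
    → (φ : Fin n → ℕ) → (∀ v → 0 < φ v)
    → (I : Fin n → Bool) → PhiMaximum G φ I
    → (p : ℕ) (u : Fin p → Fin n) → Injective _≡_ _≡_ u
    → (∀ k → I (u k) ≡ false)
    → (∀ v → I v ≡ false → ∃[ k ] (u k ≡ v))
    → (∀ k → suc (toℕ k) < p
    → count (λ j → (toℕ k <ᵇ toℕ j) ∧ adj G (u k) (u j)) ≤ φ (u k) ∸ 1)
    → ∃[ F ] WellSubgraph G φ I F
lemma1 G _ φ φ-pos I (I-ind , I-max , _) p u u-inj u∉I onto forward-bound =
  well-subgraph G φ I u u-inj u∉I onto
    (CapacitatedHall.hall-assignment φ (edgesToI G φ I u u-inj u∉I)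
      (hall-condition G φ I u u-inj u∉I φ-pos I-ind I-max forward))
  where
  forward : ∀ k → count (forwardNeighbours (pullback G u) k) ≤ φ (u k) ∸ 1
  forward k with suc (toℕ k) <? p
  ... | yes not-last = forward-bound k not-last
  ... | no last = ≤-trans (≤-reflexive (forwardNeighbours-last (pullback G u) k last)) z≤n
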